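{- Let $N=(P,T,F)$ be an ord-IO net and let $M\xrightarrow{\sigma}M'$ be an execution of $N$. Then for every marking $\bar M\ge M$ with $\mathrm{carrier}(\bar M)=\mathrm{carrier}(M)$ there exist a transition sequence $\bar\sigma$ and a marking $\bar M'\ge M'$ such that $\bar M\xrightarrow{\bar\sigma}\bar M'$ and $\mathrm{carrier}(\bar M')=\mathrm{carrier}(M')$.
   Context: A net is $N=(P,T,F)$ with $P,T$ finite disjoint and $F:(P\times T)\cup(T\times P)\to\{0,1\}$ (ordinary). Markings $M:P\to\mathbb{N}$; $t$ is enabled at $M$ if $M(p)\ge F(p,t)$ for all $p$, firing gives $M'(p)=M(p)-F(p,t)+F(t,p)$; $M\xrightarrow{\sigma}M'$ denotes firing the sequence $\sigma$. $M\le M'$ is componentwise. The carrier of $M$ is $\mathrm{carrier}(M)=\{p\in P\mid M(p)\ge1\}$. An ord-IO net is an ordinary net in which every transition $t$ satisfies, for some places $p_s,p_d$, either ${}^\bullet t=\{p_s\}$, $t^\bullet=\{p_d\}$, or, for some place $p_o$, ${}^\bullet t=\{p_s\}+\{p_o\}$ and $t^\bullet=\{p_o\}+\{p_d\}$ (multisets, with ${}^\bullet t(p)=F(p,t)$, $t^\bullet(p)=F(t,p)$). -}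

module Defs where

open import Data.Nat using (ℕ; zero; suc; _+_; _∸_; _≤_)
open import Data.Bool using (Bool; true; false)
open import Data.Fin using (Fin)
open import Data.Fin.Properties using (_≟_)
open import Data.List using (List; []; _∷_)
open import Data.Product using (_×_; ∃; ∃-syntax)
open import Data.Sum using (_⊎_)
open import Relation.Nullary using (does)
open import Relation.Binary.PropositionalEquality using (_≡_)
open import Function.Bundles using (_⇔_)

-- An ordinary net with places Fin np and transitions Fin nt.
-- F is given by its two halves with values in {0,1}.
record Net (np nt : ℕ) : Set where
  field
    pre  : Fin np → Fin nt → ℕ
    post : Fin nt → Fin np → ℕ
    pre01  : ∀ p t → (pre p t ≡ 0) ⊎ (pre p t ≡ 1)
    post01 : ∀ t p → (post t p ≡ 0) ⊎ (post t p ≡ 1)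
open Net public

Marking : ℕ → Set
Marking np = Fin np → ℕ

MSet : ℕ → Set
MSet np = Fin np → ℕ

⟦_⟧ : ∀ {np} → Fin np → MSet np
⟦ p ⟧ q = if′ (does (p ≟ q))
  where
  if′ : Bool → ℕ
  if′ true = 1
  if′ false = 0

_⊕_ : ∀ {np} → MSet np → MSet np → MSet np
(A ⊕ B) q = A q + B q

_≐_ : ∀ {np} → MSet np → MSet np → Set
A ≐ B = ∀ q → A q ≡ B q

preset : ∀ {np nt} → Net np nt → Fin nt → MSet np
preset N t p = pre N p t

postset : ∀ {np nt} → Net np nt → Fin nt → MSet np
postset N t p = post N t p

IsOrdIO : ∀ {np nt} → Net np nt → Set
IsOrdIO {np} N = ∀ t → ∃[ ps ] ∃[ pd ]
  ( (preset N t ≐ ⟦ ps ⟧ × postset N t ≐ ⟦ pd ⟧)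
  ⊎ (∃[ po ] (preset N t ≐ (⟦ ps ⟧ ⊕ ⟦ po ⟧) × postset N t ≐ (⟦ po ⟧ ⊕ ⟦ pd ⟧))) )

Enabled : ∀ {np nt} → Net np nt → Marking np → Fin nt → Set
Enabled N M t = ∀ p → pre N p t ≤ M p

Fires : ∀ {np nt} → Net np nt → Marking np → Fin nt → Marking np → Set
Fires N M t M' = Enabled N M t × (∀ p → M' p ≡ (M p ∸ pre N p t) + post N t p)

data Reach {np nt} (N : Net np nt) : Marking np → List (Fin nt) → Marking np → Set where
  done : ∀ {M} → Reach N M [] M
  step : ∀ {M M₁ M' t σ} → Fires N M t M₁ → Reach N M₁ σ M' → Reach N M (t ∷ σ) M'

_≤ᴹ_ : ∀ {np} → Marking np → Marking np → Set
M ≤ᴹ M' = ∀ p → M p ≤ M' p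

SameCarrier : ∀ {np} → Marking np → Marking np → Set
SameCarrier M M' = ∀ p → (1 ≤ M p) ⇔ (1 ≤ M' p)

-- Every transition of an ord-IO net moves one token from a source place ps to a target
-- place pd, possibly reading a catalyst place po that it leaves unchanged.  So it suffices
-- to simulate a single step M →t M₁ from a marking M̄ ≥ M with the same carrier.  If
-- ps = pd the step changes nothing.  Otherwise t is fired repeatedly from M̄, since every
-- intermediate marking still covers M and hence enables t, until the surplus M̄(ps) − M(ps)
-- has been moved to pd; one further firing of t then reaches a marking covering M₁ with
-- the same carrier: at ps both markings agree, at pd both are positive, and elsewhere
-- nothing has changed.
module Submission where

open import Defs
open import Data.Nat using (ℕ; zero; suc; _+_; _∸_; _≤_)
open import Data.Nat.Properties hiding (_≟_)
open import Data.Nat.Solver using (module +-*-Solver)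
open import Data.Fin using (Fin)
open import Data.Fin.Properties using (_≟_)
open import Data.List using (List; []; _∷_; _++_)
open import Data.Product using (_×_; ∃-syntax; _,_)
open import Data.Sum using (_⊎_; inj₁; inj₂)
open import Data.Empty using (⊥-elim)
open import Function using (_∘_)
open import Relation.Nullary using (yes; no; ¬_)
open import Relation.Binary.PropositionalEquality
open import Function.Bundles using (_⇔_; mk⇔; Equivalence)

⟦⟧-self : ∀ {np} (p : Fin np) → ⟦ p ⟧ p ≡ 1
⟦⟧-self p with p ≟ p
... | yes _ = refl
... | no p≢p = ⊥-elim (p≢p refl)

⟦⟧-other : ∀ {np} {p q : Fin np} → ¬ p ≡ q → ⟦ p ⟧ q ≡ 0
⟦⟧-other {p = p} {q} p≢q with p ≟ q
... | yes p≡q = ⊥-elim (p≢q p≡q)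
... | no _ = refl

reach-++ : ∀ {np nt} {N : Net np nt} {A B C σ τ} →
  Reach N A σ B → Reach N B τ C → Reach N A (σ ++ τ) C
reach-++ done r = r
reach-++ (step f r) r′ = step f (reach-++ r r′)

Covers : ∀ {np} → Marking np → Marking np → Set
Covers X Z = Z ≤ᴹ X × SameCarrier X Z

CarrierWithin : ∀ {np} → Marking np → Marking np → Fin np → Set
CarrierWithin X Z p = ∀ q → 1 ≤ X q → 1 ≤ Z q ⊎ q ≡ p

covers⇒carrierWithin : ∀ {np} {X Z : Marking np} {p} → Covers X Z → CarrierWithin X Z p
covers⇒carrierWithin (_ , same) q 1≤Xq = inj₁ (Equivalence.to (same q) 1≤Xq)

record Moves {np} (ps pd : Fin np) (X Y : Marking np) : Set where
  constructor balance
  field moves : ∀ q → Y q + ⟦ ps ⟧ q ≡ X q + ⟦ pd ⟧ q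

module _ {np} {ps pd : Fin np} {X Y : Marking np} (XY : Moves ps pd X Y) where

  open Moves XY

  moves-≐ : ps ≡ pd → ∀ q → Y q ≡ X q
  moves-≐ refl q = +-cancelʳ-≡ (⟦ ps ⟧ q) _ _ (moves q)

  moves-source : ¬ ps ≡ pd → suc (Y ps) ≡ X ps
  moves-source ps≢pd = begin
    suc (Y ps)        ≡⟨ +-comm 1 (Y ps) ⟩
    Y ps + 1          ≡⟨ cong (Y ps +_) (sym (⟦⟧-self ps)) ⟩
    Y ps + ⟦ ps ⟧ ps  ≡⟨ moves ps ⟩
    X ps + ⟦ pd ⟧ ps  ≡⟨ cong (X ps +_) (⟦⟧-other (ps≢pd ∘ sym)) ⟩
    X ps + 0          ≡⟨ +-identityʳ (X ps) ⟩
    X ps              ∎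
    where open ≡-Reasoning

  moves-≤ : ∀ {q} → ¬ q ≡ ps → X q ≤ Y q
  moves-≤ {q} q≢ps = begin
    X q              ≤⟨ m≤m+n (X q) (⟦ pd ⟧ q) ⟩
    X q + ⟦ pd ⟧ q   ≡⟨ sym (moves q) ⟩
    Y q + ⟦ ps ⟧ q   ≡⟨ cong (Y q +_) (⟦⟧-other (q≢ps ∘ sym)) ⟩
    Y q + 0          ≡⟨ +-identityʳ (Y q) ⟩
    Y q              ∎
    where open ≤-Reasoning

  moves-elsewhere : ∀ {q} → ¬ q ≡ ps → ¬ q ≡ pd → Y q ≡ X q
  moves-elsewhere {q} q≢ps q≢pd = begin
    Y q              ≡⟨ sym (+-identityʳ (Y q)) ⟩
    Y q + 0          ≡⟨ cong (Y q +_) (sym (⟦⟧-other (q≢ps ∘ sym))) ⟩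
    Y q + ⟦ ps ⟧ q   ≡⟨ moves q ⟩
    X q + ⟦ pd ⟧ q   ≡⟨ cong (X q +_) (⟦⟧-other (q≢pd ∘ sym)) ⟩
    X q + 0          ≡⟨ +-identityʳ (X q) ⟩
    X q              ∎
    where open ≡-Reasoning

moves-mono : ∀ {np} {ps pd : Fin np} {X Y Z W : Marking np} →
  Moves ps pd X Y → Moves ps pd Z W → Z ≤ᴹ X → W ≤ᴹ Y
moves-mono {ps = ps} {pd} {X} {Y} {Z} {W} (balance XY) (balance ZW) Z≤X q =
  +-cancelʳ-≤ (⟦ ps ⟧ q) (W q) (Y q) (begin
    W q + ⟦ ps ⟧ q  ≡⟨ ZW q ⟩
    Z q + ⟦ pd ⟧ q  ≤⟨ +-monoˡ-≤ (⟦ pd ⟧ q) (Z≤X q) ⟩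
    X q + ⟦ pd ⟧ q  ≡⟨ sym (XY q) ⟩
    Y q + ⟦ ps ⟧ q  ∎)
  where open ≤-Reasoning

-- The common shape of both kinds of ord-IO transitions; the catalyst is empty or {po}.
record IsTransfer {np nt} (N : Net np nt) (t : Fin nt) (ps pd : Fin np) : Set where
  constructor transfers
  field
    catalyst : MSet np
    pre≐ : preset N t ≐ (⟦ ps ⟧ ⊕ catalyst)
    post≐ : postset N t ≐ (catalyst ⊕ ⟦ pd ⟧)

ordIO⇒transfer : ∀ {np nt} {N : Net np nt} → IsOrdIO N →
  ∀ t → ∃[ ps ] ∃[ pd ] IsTransfer N t ps pd
ordIO⇒transfer io t with io t
... | ps , pd , inj₁ (pre≐ , post≐) =
  ps , pd , transfers (λ _ → 0) (λ q → trans (pre≐ q) (sym (+-identityʳ _))) post≐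
... | ps , pd , inj₂ (po , pre≐ , post≐) = ps , pd , transfers ⟦ po ⟧ pre≐ post≐

module Transfer {np nt} {N : Net np nt} {t : Fin nt} {ps pd : Fin np}
  (transfer : IsTransfer N t ps pd) where

  open IsTransfer transfer renaming (catalyst to c)

  fires-moves : ∀ {X Y} → Fires N X t Y → Moves ps pd X Y
  fires-moves {X} {Y} (enabled , Y≐) = balance balanced
    where
    balanced : ∀ q → Y q + ⟦ ps ⟧ q ≡ X q + ⟦ pd ⟧ q
    balanced q = begin
      Y q + ⟦ ps ⟧ q                  ≡⟨ cong (_+ ⟦ ps ⟧ q) (Y≐ q) ⟩
      d + post N t q + ⟦ ps ⟧ q       ≡⟨ cong (λ z → d + z + ⟦ ps ⟧ q) (post≐ q) ⟩
      d + (c q + ⟦ pd ⟧ q) + ⟦ ps ⟧ q ≡⟨ solve 4 (λ d c a b → d :+ (c :+ b) :+ a := d :+ (a :+ c) :+ b)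
                                            refl d (c q) (⟦ ps ⟧ q) (⟦ pd ⟧ q) ⟩
      d + (⟦ ps ⟧ q + c q) + ⟦ pd ⟧ q ≡⟨ cong (λ z → d + z + ⟦ pd ⟧ q) (sym (pre≐ q)) ⟩
      d + pre N q t + ⟦ pd ⟧ q        ≡⟨ cong (_+ ⟦ pd ⟧ q) (m∸n+n≡m (enabled q)) ⟩
      X q + ⟦ pd ⟧ q                  ∎
      where
      open ≡-Reasoning
      open +-*-Solver using (solve; _:+_; _:=_)
      d : ℕ
      d = X q ∸ pre N q t

  fires-target : ∀ {X Y} → Fires N X t Y → 1 ≤ Y pd
  fires-target {X} {Y} (_ , Y≐) = begin
    1                                  ≤⟨ m≤n+m 1 (c pd) ⟩
    c pd + 1                           ≡⟨ cong (c pd +_) (sym (⟦⟧-self pd)) ⟩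
    c pd + ⟦ pd ⟧ pd                   ≡⟨ sym (post≐ pd) ⟩
    post N t pd                        ≤⟨ m≤n+m _ (X pd ∸ pre N pd t) ⟩
    (X pd ∸ pre N pd t) + post N t pd  ≡⟨ sym (Y≐ pd) ⟩
    Y pd                               ∎
    where open ≤-Reasoning

  enabled-source : ∀ {X} → Enabled N X t → 1 ≤ X ps
  enabled-source {X} enabled = begin
    1                   ≤⟨ m≤m+n 1 (c ps) ⟩
    1 + c ps            ≡⟨ cong (_+ c ps) (sym (⟦⟧-self ps)) ⟩
    ⟦ ps ⟧ ps + c ps    ≡⟨ sym (pre≐ ps) ⟩
    pre N ps t          ≤⟨ enabled ps ⟩
    X ps                ∎
    where open ≤-Reasoning

  fire : Marking np → Marking np
  fire X q = (X q ∸ pre N q t) + post N t q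

  fires-above : ∀ {M X} → Enabled N M t → M ≤ᴹ X → Fires N X t (fire X)
  fires-above enabled M≤X = (λ q → ≤-trans (enabled q) (M≤X q)) , (λ _ → refl)

  module _ (ps≢pd : ¬ ps ≡ pd) {M : Marking np} (enabled : Enabled N M t) where

    drain : ∀ n X → X ps ≡ M ps + n → M ≤ᴹ X → CarrierWithin X M pd →
      ∃[ σ ] ∃[ X′ ] (Reach N X σ X′ × X′ ps ≡ M ps × M ≤ᴹ X′ × CarrierWithin X′ M pd)
    drain zero X Xps≡ M≤X within = [] , X , done , trans Xps≡ (+-identityʳ _) , M≤X , within
    drain (suc n) X Xps≡ M≤X within
      with drain n (fire X) Yps≡ M≤Y withinY
      where
      moves : Moves ps pd X (fire X)
      moves = fires-moves (fires-above enabled M≤X)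
      Yps≡ : fire X ps ≡ M ps + n
      Yps≡ = suc-injective (trans (moves-source moves ps≢pd) (trans Xps≡ (+-suc (M ps) n)))
      M≤Y : M ≤ᴹ fire X
      M≤Y q with q ≟ ps
      ... | yes refl = subst (M ps ≤_) (sym Yps≡) (m≤m+n (M ps) n)
      ... | no q≢ps = ≤-trans (M≤X q) (moves-≤ moves q≢ps)
      withinY : CarrierWithin (fire X) M pd
      withinY q 1≤Yq with q ≟ ps | q ≟ pd
      ... | yes refl | _ = inj₁ (enabled-source enabled)
      ... | no _ | yes q≡pd = inj₂ q≡pd
      ... | no q≢ps | no q≢pd = within q (subst (1 ≤_) (moves-elsewhere moves q≢ps q≢pd) 1≤Yq)
    ... | σ , X′ , reach , rest = t ∷ σ , X′ , step (fires-above enabled M≤X) reach , rest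

    fire-covers : ∀ {X Y M₁} → Fires N X t Y → Fires N M t M₁ →
      X ps ≡ M ps → M ≤ᴹ X → CarrierWithin X M pd → Covers Y M₁
    fire-covers {X} {Y} {M₁} XY MM₁ Xps≡Mps M≤X within =
      M₁≤Y , λ q → mk⇔ (to q) (λ 1≤M₁q → ≤-trans 1≤M₁q (M₁≤Y q))
      where
      M₁≤Y : M₁ ≤ᴹ Y
      M₁≤Y = moves-mono (fires-moves XY) (fires-moves MM₁) M≤X
      to : ∀ q → 1 ≤ Y q → 1 ≤ M₁ q
      to q 1≤Yq with q ≟ ps | q ≟ pd
      ... | yes refl | _ = subst (1 ≤_) Yps≡M₁ps 1≤Yq
        where
        Yps≡M₁ps : Y ps ≡ M₁ ps
        Yps≡M₁ps = suc-injective (trans (moves-source (fires-moves XY) ps≢pd)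
                     (trans Xps≡Mps (sym (moves-source (fires-moves MM₁) ps≢pd))))
      ... | no _ | yes refl = fires-target MM₁
      ... | no q≢ps | no q≢pd
        with within q (subst (1 ≤_) (moves-elsewhere (fires-moves XY) q≢ps q≢pd) 1≤Yq)
      ...   | inj₁ 1≤Mq = subst (1 ≤_) (sym (moves-elsewhere (fires-moves MM₁) q≢ps q≢pd)) 1≤Mq
      ...   | inj₂ q≡pd = ⊥-elim (q≢pd q≡pd)

  step-covered : ∀ {M M₁ M̄} → Fires N M t M₁ → Covers M̄ M →
    ∃[ σ ] ∃[ M̄′ ] (Reach N M̄ σ M̄′ × Covers M̄′ M₁)
  step-covered {M} {M₁} {M̄} MM₁@(enabled , _) covers@(M≤M̄ , same) with ps ≟ pd
  ... | yes ps≡pd = [] , M̄ , done ,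
      (λ q → subst (_≤ M̄ q) (sym (M₁≐M q)) (M≤M̄ q)) ,
      (λ q → subst (λ z → (1 ≤ M̄ q) ⇔ (1 ≤ z)) (sym (M₁≐M q)) (same q))
    where
    M₁≐M : ∀ q → M₁ q ≡ M q
    M₁≐M = moves-≐ (fires-moves MM₁) ps≡pd
  ... | no ps≢pd
    with drain ps≢pd enabled (M̄ ps ∸ M ps) M̄ (sym (m+[n∸m]≡n (M≤M̄ ps)))
           M≤M̄ (covers⇒carrierWithin covers)
  ... | σ , X , reach , Xps≡Mps , M≤X , within =
      σ ++ t ∷ [] , fire X ,
      reach-++ reach (step (fires-above enabled M≤X) done) ,
      fire-covers ps≢pd enabled (fires-above enabled M≤X) MM₁ Xps≡Mps M≤X within

reach-covered : ∀ {np nt} {N : Net np nt} → IsOrdIO N → ∀ {M M′ σ M̄} →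
  Reach N M σ M′ → Covers M̄ M → ∃[ σ̄ ] ∃[ M̄′ ] (Reach N M̄ σ̄ M̄′ × Covers M̄′ M′)
reach-covered io done covers = [] , _ , done , covers
reach-covered io {σ = t ∷ _} (step MM₁ M₁M′) covers
  with ordIO⇒transfer io t
... | _ , _ , transfer
  with Transfer.step-covered transfer MM₁ covers
... | σ₁ , M̄₁ , M̄M̄₁ , covers₁
  with reach-covered io M₁M′ covers₁
... | σ₂ , M̄′ , M̄₁M̄′ , covers′ = σ₁ ++ σ₂ , M̄′ , reach-++ M̄M̄₁ M̄₁M̄′ , covers′

proposition3p2 : ∀ {np nt} (N : Net np nt) → IsOrdIO N →
    ∀ (M M' : Marking np) (σ : List (Fin nt)) → Reach N M σ M' →
    ∀ (Mb : Marking np) → M ≤ᴹ Mb → SameCarrier Mb M →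
    ∃[ σb ] ∃[ Mb' ] (Reach N Mb σb Mb' × M' ≤ᴹ Mb' × SameCarrier Mb' M')
proposition3p2 N io M M' σ reach Mb M≤Mb same = reach-covered io reach (M≤Mb , same)
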